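{- For any positive integer $q$, the weaving square $W_{4q}$ satisfies: (1) every integer from $1$ to $16q^2$ appears in $W_{4q}$ exactly once; (2) all row sums and all column sums equal $32q^3+2q$; (3) every row and every column contains (among its entries) two disjoint 1-APs of length $q$; (4) for $(i,j)\in[4q]\times[4q]$, $W_{4q}(i,j)\le 8q^2$ if and only if $i,j\le 2q$ or $i,j>2q$.
   Context: $[a]=\{1,\dots,a\}$; a 1-AP is a set of consecutive integers. The little square $L_q$ is the $q\times q$ array with $L_q(i,j)=q(i-1)+j$. Its rotations are $L^0_q=L_q$, $L^1_q(i,j)=L_q(q+1-j,i)$, $L^2_q(i,j)=L_q(q+1-i,q+1-j)$, $L^3_q(i,j)=L_q(j,q+1-i)$. The base square is the $4\times4$ array $B$ with rows $(1,6,11,16)$, $(7,4,13,10)$, $(12,15,2,5)$, $(14,9,8,3)$. The weaving square $W_{4q}$ is the $4q\times 4q$ array defined as follows: for $(i,j)\in[4q]\times[4q]$ write uniquely $i=q(i_1-1)+i_2$, $j=q(j_1-1)+j_2$ with $i_1,j_1\in[4]$, $i_2,j_2\in[q]$, and set $W_{4q}(i,j)=(B(i_1,j_1)-1)q^2+L_q^{(j_1-i_1\bmod 4)}(i_2,j_2)$. -}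

module Defs where

open import Data.Nat using (ℕ; zero; suc; _+_; _*_; _∸_; _≤_; _<_)
open import Data.Nat.DivMod using (_mod_)
open import Data.Fin using (Fin; toℕ; opposite; remQuot)
open import Data.Fin.Patterns
open import Data.Product using (_×_; _,_; proj₁; proj₂; Σ-syntax; ∃-syntax)
open import Data.Vec using (Vec; []; _∷_; lookup)

-- Conventions: row/column indices are 0-based elements of Fin; the paper's
-- 1-based index i corresponds to toℕ i + 1.  Entries are natural numbers.

L : (q : ℕ) → Fin q → Fin q → ℕ
L q a b = q * toℕ a + toℕ b + 1

-- rotations L^r_q ; opposite a = q-1-a (0-based version of q+1-a)
Lrot : (q : ℕ) → Fin 4 → Fin q → Fin q → ℕ
Lrot q 0F a b = L q a b
Lrot q 1F a b = L q (opposite b) a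
Lrot q 2F a b = L q (opposite a) (opposite b)
Lrot q 3F a b = L q b (opposite a)

B : Fin 4 → Fin 4 → ℕ
B i j = lookup (lookup rows i) j
  where
  rows : Vec (Vec ℕ 4) 4
  rows = (1 ∷ 6 ∷ 11 ∷ 16 ∷ [])
       ∷ (7 ∷ 4 ∷ 13 ∷ 10 ∷ [])
       ∷ (12 ∷ 15 ∷ 2 ∷ 5 ∷ [])
       ∷ (14 ∷ 9 ∷ 8 ∷ 3 ∷ [])
       ∷ []

rotIndex : Fin 4 → Fin 4 → Fin 4
rotIndex i₁ j₁ = (4 + toℕ j₁ ∸ toℕ i₁) mod 4

-- weaving square W_{4q}; remQuot {4} q i = (i₁ , i₂) with toℕ i = q * toℕ i₁ + toℕ i₂
W : (q : ℕ) → Fin (4 * q) → Fin (4 * q) → ℕ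
W q i j =
  let i₁ = proj₁ (remQuot {4} q i) ; i₂ = proj₂ (remQuot {4} q i)
      j₁ = proj₁ (remQuot {4} q j) ; j₂ = proj₂ (remQuot {4} q j)
  in (B i₁ j₁ ∸ 1) * (q * q) + Lrot q (rotIndex i₁ j₁) i₂ j₂

APIn : {n : ℕ} → (f : Fin n → ℕ) → (a len : ℕ) → Set
APIn {n} f a len = ∀ k → k < len → ∃[ j ] f j ≡ a + k
  where open import Relation.Binary.PropositionalEquality using (_≡_)

TwoDisjointAPs : {n : ℕ} → (Fin n → ℕ) → ℕ → Set
TwoDisjointAPs f len =
  Σ[ a ∈ ℕ ] Σ[ b ∈ ℕ ] (APIn f a len × APIn f b len × (a + len ≤ b))

{-# OPTIONS --safe #-}
module Submission where

-- Write a row index as q·i₁ + i₂ with i₁ < 4, i₂ < q, and likewise a column index. Then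
-- W(i,j) − 1 = (B(i₁,j₁) − 1)·q² + (L^r(i₂,j₂) − 1) with r = j₁ − i₁ mod 4: a two-digit numeral in
-- base q² whose digits run bijectively over [0,16) (B is a permutation of 1..16) and over [0,q²)
-- (each rotation of L_q is a bijection onto 1..q²), which gives (1). The leading digit is below 8
-- exactly on the two diagonal 2×2 blocks of B, which gives (4). Every line of W crosses four blocks
-- carrying the four rotations, L^r + L^(r+2) = q² + 1 pointwise, and the digits B − 1 along a line of
-- B sum to 30, which gives (2). The rotation-0 and rotation-2 blocks of a row (rotation-1 and
-- rotation-3 blocks of a column) each contain q consecutive integers, in ranges separated by their
-- distinct leading digits, which gives (3).

open import Defs
open import Data.Nat.Properties
open import Algebra.Properties.Semiring.Sum +-*-semiring
  using (sum-syntax; sum-cong-≗; ∑-comm; ∑-distrib-+; *-distribʳ-sum; sum-permute)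
  renaming (sum to ∑)
open import Data.Fin using (Fin; zero; suc; toℕ; opposite; remQuot; quotient; remainder; combine; fromℕ<; _↑ˡ_; _↑ʳ_)
open import Data.Fin.Patterns
open import Data.Fin.Permutation using (Permutation′; permutation)
open import Data.Fin.Properties as Fin
  using ( toℕ-combine; combine-injective; combine-injectiveˡ; combine-injectiveʳ; remQuot-combine
        ; combine-remQuot; toℕ-fromℕ<; toℕ-injective; toℕ<n; toℕ≤pred[n]; opposite-prop
        ; opposite-involutive; all?; any?)
open import Data.Nat using (ℕ; zero; suc; _+_; _*_; _∸_; _≤_; _<_; _^_; _<?_; _≤?_)
open import Data.Nat.Tactic.RingSolver using (solve-∀)
open import Data.Product using (_×_; _,_; Σ-syntax; ∃; ∃₂; proj₁; proj₂; uncurry)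
open import Data.Product.Function.NonDependent.Propositional using (_×-⇔_)
open import Data.Sum using (_⊎_)
open import Data.Sum.Function.Propositional using (_⊎-⇔_)
open import Data.Vec using (sum; tabulate)
open import Function using (_∘_; _⇔_; mk⇔)
open import Function.Construct.Composition using (_⇔-∘_)
open import Function.Construct.Symmetry using (⇔-sym)
open import Relation.Binary.PropositionalEquality
open import Relation.Nullary.Decidable using (Dec; from-yes; _×-dec_; _⊎-dec_; _→-dec_)

sum-tabulate : ∀ {n} (f : Fin n → ℕ) → sum (tabulate f) ≡ ∑[ i < n ] f i
sum-tabulate {zero}  f = refl
sum-tabulate {suc n} f = cong (f zero +_) (sum-tabulate (f ∘ suc))

∑-const : ∀ n c → ∑[ i < n ] c ≡ n * c
∑-const zero    c = refl
∑-const (suc n) c = cong (c +_) (∑-const n c)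

∑-↑ : ∀ m {n} (f : Fin (m + n) → ℕ) →
      ∑[ k < m + n ] f k ≡ ∑[ i < m ] f (i ↑ˡ n) + ∑[ j < n ] f (m ↑ʳ j)
∑-↑ zero    f = refl
∑-↑ (suc m) f = trans (cong (f zero +_) (∑-↑ m (f ∘ suc))) (sym (+-assoc (f zero) _ _))

∑-combine : ∀ m {n} (f : Fin (m * n) → ℕ) →
            ∑[ k < m * n ] f k ≡ ∑[ i < m ] ∑[ j < n ] f (combine i j)
∑-combine zero        f = refl
∑-combine (suc m) {n} f =
  trans (∑-↑ n f) (cong (∑[ j < n ] f (j ↑ˡ (m * n)) +_) (∑-combine m (f ∘ (n ↑ʳ_))))

combine-elim : ∀ {m n p} (P : Fin (m * n) → Set p) → (∀ a b → P (combine a b)) → ∀ i → P i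
combine-elim {m} {n} P h i = subst P (combine-remQuot {m} n i) (h (quotient {m} n i) (remainder {m} n i))

remQuot-injective : ∀ {m} n {i j : Fin (m * n)} → remQuot {m} n i ≡ remQuot n j → i ≡ j
remQuot-injective {m} n {i} {j} e =
  trans (sym (combine-remQuot {m} n i)) (trans (cong (uncurry combine) e) (combine-remQuot {m} n j))

uncurry-combine-injective : ∀ {m n} {p p′ : Fin m × Fin n} →
                            uncurry combine p ≡ uncurry combine p′ → p ≡ p′
uncurry-combine-injective {p = a , b} {c , d} e with combine-injective a b c d e
... | refl , refl = refl

combine-<-from : ∀ {m n k} (a : Fin m) (b : Fin n) → toℕ a < k → toℕ (combine a b) < k * n
combine-<-from {n = n} {k} a b a<k = begin-strict
  toℕ (combine a b)   ≡⟨ toℕ-combine a b ⟩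
  n * toℕ a + toℕ b   <⟨ +-monoʳ-< (n * toℕ a) (toℕ<n b) ⟩
  n * toℕ a + n       ≡⟨ +-comm (n * toℕ a) n ⟩
  n + n * toℕ a       ≡⟨ *-suc n (toℕ a) ⟨
  n * suc (toℕ a)     ≤⟨ *-monoʳ-≤ n a<k ⟩
  n * k               ≡⟨ *-comm n k ⟩
  k * n               ∎
  where open ≤-Reasoning

combine-≥-from : ∀ {m n k} (a : Fin m) (b : Fin n) → k ≤ toℕ a → k * n ≤ toℕ (combine a b)
combine-≥-from {n = n} {k} a b k≤a = begin
  k * n               ≡⟨ *-comm k n ⟩
  n * k               ≤⟨ *-monoʳ-≤ n k≤a ⟩
  n * toℕ a           ≤⟨ m≤m+n (n * toℕ a) (toℕ b) ⟩
  n * toℕ a + toℕ b   ≡⟨ toℕ-combine a b ⟨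
  toℕ (combine a b)   ∎
  where open ≤-Reasoning

toℕ-combine-< : ∀ {m n} k (a : Fin m) (b : Fin n) → toℕ (combine a b) < k * n ⇔ toℕ a < k
toℕ-combine-< k a b = mk⇔
  (λ lt → ≰⇒> (λ k≤a → <⇒≱ lt (combine-≥-from a b k≤a)))
  (combine-<-from a b)

toℕ-combine-≥ : ∀ {m n} k (a : Fin m) (b : Fin n) → k * n ≤ toℕ (combine a b) ⇔ k ≤ toℕ a
toℕ-combine-≥ k a b = mk⇔
  (λ ge → ≮⇒≥ (λ a<k → <⇒≱ (combine-<-from a b a<k) ge))
  (combine-≥-from a b)

SameSide : ℕ → ℕ → ℕ → Set
SameSide m x y = (x < m × y < m) ⊎ (m ≤ x × m ≤ y)

sameSide? : ∀ m x y → Dec (SameSide m x y)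
sameSide? m x y = ((x <? m) ×-dec (y <? m)) ⊎-dec ((m ≤? x) ×-dec (m ≤? y))

sameSide-combine : ∀ {m n} k (a c : Fin m) (b d : Fin n) →
                   SameSide (k * n) (toℕ (combine a b)) (toℕ (combine c d)) ⇔ SameSide k (toℕ a) (toℕ c)
sameSide-combine k a c b d =
  (toℕ-combine-< k a b ×-⇔ toℕ-combine-< k c d) ⊎-⇔ (toℕ-combine-≥ k a b ×-⇔ toℕ-combine-≥ k c d)

exactly-once : ∀ {a} {A : Set a} {n} (g : A → ℕ) (f : A → Fin n) → (∀ x → g x ≡ suc (toℕ (f x))) →
               (∀ {x y} → f x ≡ f y → x ≡ y) → (∀ k → ∃ λ x → f x ≡ k) →
               ∀ v → 1 ≤ v → v ≤ n → Σ[ x ∈ A ] (g x ≡ v × ∀ y → g y ≡ v → y ≡ x)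
exactly-once g f g≡ injective surjective (suc m) _ m<n = x , gx≡ , unique
  where
  x = proj₁ (surjective (fromℕ< m<n))
  gx≡ : g x ≡ suc m
  gx≡ = trans (g≡ x) (cong suc (trans (cong toℕ (proj₂ (surjective (fromℕ< m<n)))) (toℕ-fromℕ< m<n)))
  unique : ∀ y → g y ≡ suc m → y ≡ x
  unique y gy≡ = injective (toℕ-injective (suc-injective (trans (sym (g≡ y)) (trans gy≡ (trans (sym gx≡) (g≡ x))))))

-- The little square and its rotations

L≡suc-combine : ∀ q (a b : Fin q) → L q a b ≡ suc (toℕ (combine a b))
L≡suc-combine q a b = trans (+-comm _ 1) (cong suc (sym (toℕ-combine a b)))

rotate : ∀ {q} → Fin 4 → Fin q × Fin q → Fin q × Fin q
rotate 0F (a , b) = a , b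
rotate 1F (a , b) = opposite b , a
rotate 2F (a , b) = opposite a , opposite b
rotate 3F (a , b) = b , opposite a

Lrot≡suc-combine : ∀ q r (a b : Fin q) → Lrot q r a b ≡ suc (toℕ (uncurry combine (rotate r (a , b))))
Lrot≡suc-combine q 0F a b = L≡suc-combine q a b
Lrot≡suc-combine q 1F a b = L≡suc-combine q (opposite b) a
Lrot≡suc-combine q 2F a b = L≡suc-combine q (opposite a) (opposite b)
Lrot≡suc-combine q 3F a b = L≡suc-combine q b (opposite a)

negate₄ : Fin 4 → Fin 4
negate₄ r = rotIndex r 0F

rotate-inverseˡ : ∀ {q} r (p : Fin q × Fin q) → rotate (negate₄ r) (rotate r p) ≡ p
rotate-inverseˡ 0F p       = refl
rotate-inverseˡ 1F (a , b) = cong (a ,_) (opposite-involutive b)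
rotate-inverseˡ 2F (a , b) = cong₂ _,_ (opposite-involutive a) (opposite-involutive b)
rotate-inverseˡ 3F (a , b) = cong (_, b) (opposite-involutive a)

rotate-inverseʳ : ∀ {q} r (p : Fin q × Fin q) → rotate r (rotate (negate₄ r) p) ≡ p
rotate-inverseʳ 0F p       = refl
rotate-inverseʳ 1F (a , b) = cong (_, b) (opposite-involutive a)
rotate-inverseʳ 2F (a , b) = cong₂ _,_ (opposite-involutive a) (opposite-involutive b)
rotate-inverseʳ 3F (a , b) = cong (a ,_) (opposite-involutive b)

rotate-injective : ∀ {q} r {p p′ : Fin q × Fin q} → rotate r p ≡ rotate r p′ → p ≡ p′
rotate-injective r {p} {p′} e =
  trans (sym (rotate-inverseˡ r p)) (trans (cong (rotate (negate₄ r)) e) (rotate-inverseˡ r p′))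

toℕ+toℕ-opposite : ∀ {p} (a : Fin (suc p)) → toℕ a + toℕ (opposite a) ≡ p
toℕ+toℕ-opposite a = trans (cong (toℕ a +_) (opposite-prop a)) (m+[n∸m]≡n (toℕ≤pred[n] a))

L-complement : ∀ {q} (a b : Fin q) → L q a b + L q (opposite a) (opposite b) ≡ q * q + 1
L-complement {suc p} a b = begin
  (q * toℕ a + toℕ b + 1) + (q * toℕ a′ + toℕ b′ + 1)
    ≡⟨ regroup q (toℕ a) (toℕ b) (toℕ a′) (toℕ b′) ⟩
  q * (toℕ a + toℕ a′) + (toℕ b + toℕ b′) + 2
    ≡⟨ cong₂ (λ x y → q * x + y + 2) (toℕ+toℕ-opposite a) (toℕ+toℕ-opposite b) ⟩
  q * p + p + 2
    ≡⟨ square p ⟩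
  q * q + 1
    ∎
  where
  open ≡-Reasoning
  q = suc p
  a′ = opposite a
  b′ = opposite b
  regroup : ∀ q x y x′ y′ → (q * x + y + 1) + (q * x′ + y′ + 1) ≡ q * (x + x′) + (y + y′) + 2
  regroup = solve-∀
  square : ∀ p → suc p * p + p + 2 ≡ suc p * suc p + 1
  square = solve-∀

∑-rotations : ∀ {q} (a b : Fin q) → ∑[ r < 4 ] Lrot q r a b ≡ 2 * (q * q + 1)
∑-rotations {q} a b = begin
  L₀ + (L₁ + (L₂ + (L₃ + 0))) ≡⟨ regroup L₀ L₁ L₂ L₃ ⟩
  (L₀ + L₂) + (L₁ + L₃)       ≡⟨ cong₂ _+_ (L-complement a b) L₁+L₃ ⟩
  (q * q + 1) + (q * q + 1)   ≡⟨ cong ((q * q + 1) +_) (+-identityʳ (q * q + 1)) ⟨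
  2 * (q * q + 1)             ∎
  where
  open ≡-Reasoning
  L₀ = Lrot q 0F a b
  L₁ = Lrot q 1F a b
  L₂ = Lrot q 2F a b
  L₃ = Lrot q 3F a b
  L₁+L₃ : L₁ + L₃ ≡ q * q + 1
  L₁+L₃ = subst (λ c → L₁ + L q c (opposite a) ≡ q * q + 1) (opposite-involutive b) (L-complement (opposite b) a)
  regroup : ∀ x y z w → x + (y + (z + (w + 0))) ≡ (x + z) + (y + w)
  regroup = solve-∀

-- The base square

B-bound : ∀ i j → B i j ∸ 1 < 16
B-bound = from-yes (all? λ i → all? λ j → B i j ∸ 1 <? 16)

Bᶠ : Fin 4 → Fin 4 → Fin 16
Bᶠ i j = fromℕ< (B-bound i j)

Bᶠ-injective : ∀ i j i′ j′ → Bᶠ i j ≡ Bᶠ i′ j′ → i ≡ i′ × j ≡ j′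
Bᶠ-injective = from-yes (all? λ i → all? λ j → all? λ i′ → all? λ j′ →
  (Bᶠ i j Fin.≟ Bᶠ i′ j′) →-dec ((i Fin.≟ i′) ×-dec (j Fin.≟ j′)))

Bᶠ-surjective : ∀ c → ∃₂ λ i j → Bᶠ i j ≡ c
Bᶠ-surjective = from-yes (all? λ c → any? λ i → any? λ j → Bᶠ i j Fin.≟ c)

B-row-sum : ∀ i → ∑[ j < 4 ] (B i j ∸ 1) ≡ 30
B-row-sum = from-yes (all? λ i → ∑[ j < 4 ] (B i j ∸ 1) ≟ 30)

B-column-sum : ∀ j → ∑[ i < 4 ] (B i j ∸ 1) ≡ 30
B-column-sum = from-yes (all? λ j → ∑[ i < 4 ] (B i j ∸ 1) ≟ 30)

Bᶠ-small⇔sameSide : ∀ i j → toℕ (Bᶠ i j) < 8 ⇔ SameSide 2 (toℕ i) (toℕ j)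
Bᶠ-small⇔sameSide i j = uncurry mk⇔ (decided i j)
  where
  decided : ∀ i j → (toℕ (Bᶠ i j) < 8 → SameSide 2 (toℕ i) (toℕ j))
                  × (SameSide 2 (toℕ i) (toℕ j) → toℕ (Bᶠ i j) < 8)
  decided = from-yes (all? λ i → all? λ j →
    ((toℕ (Bᶠ i j) <? 8) →-dec sameSide? 2 (toℕ i) (toℕ j))
    ×-dec (sameSide? 2 (toℕ i) (toℕ j) →-dec (toℕ (Bᶠ i j) <? 8)))

rowPermutation : Fin 4 → Permutation′ 4
rowPermutation i = permutation (rotIndex i) (rotIndex (negate₄ i)) (inverseˡ i) (inverseʳ i)
  where
  inverseˡ : ∀ i r → rotIndex i (rotIndex (negate₄ i) r) ≡ r
  inverseˡ = from-yes (all? λ i → all? λ r → rotIndex i (rotIndex (negate₄ i) r) Fin.≟ r)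
  inverseʳ : ∀ i j → rotIndex (negate₄ i) (rotIndex i j) ≡ j
  inverseʳ = from-yes (all? λ i → all? λ j → rotIndex (negate₄ i) (rotIndex i j) Fin.≟ j)

columnPermutation : Fin 4 → Permutation′ 4
columnPermutation j = permutation (λ i → rotIndex i j) (λ i → rotIndex i j) (involutive j) (involutive j)
  where
  involutive : ∀ j i → rotIndex (rotIndex i j) j ≡ i
  involutive = from-yes (all? λ j → all? λ i → rotIndex (rotIndex i j) j Fin.≟ i)

∑-rotIndexʳ : ∀ i (h : Fin 4 → ℕ) → ∑[ j < 4 ] h (rotIndex i j) ≡ ∑[ r < 4 ] h r
∑-rotIndexʳ i h = sym (sum-permute h (rowPermutation i))

∑-rotIndexˡ : ∀ j (h : Fin 4 → ℕ) → ∑[ i < 4 ] h (rotIndex i j) ≡ ∑[ r < 4 ] h r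
∑-rotIndexˡ j h = sym (sum-permute h (columnPermutation j))

-- Block coordinates and the bijection onto 1..16q²

Wᵇ : ∀ q → Fin 4 × Fin q → Fin 4 × Fin q → ℕ
Wᵇ q (i₁ , i₂) (j₁ , j₂) = (B i₁ j₁ ∸ 1) * (q * q) + Lrot q (rotIndex i₁ j₁) i₂ j₂

W-combine : ∀ q i₁ i₂ j₁ j₂ → W q (combine i₁ i₂) (combine j₁ j₂) ≡ Wᵇ q (i₁ , i₂) (j₁ , j₂)
W-combine q i₁ i₂ j₁ j₂ = cong₂ (Wᵇ q) (remQuot-combine {4} {q} i₁ i₂) (remQuot-combine {4} {q} j₁ j₂)

blockIndex : ∀ q → Fin 4 × Fin q → Fin 4 × Fin q → Fin (16 * (q * q))
blockIndex q (i₁ , i₂) (j₁ , j₂) = combine (Bᶠ i₁ j₁) (uncurry combine (rotate (rotIndex i₁ j₁) (i₂ , j₂)))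

Wᵇ≡suc-blockIndex : ∀ q x y → Wᵇ q x y ≡ suc (toℕ (blockIndex q x y))
Wᵇ≡suc-blockIndex q (i₁ , i₂) (j₁ , j₂) = begin
  (B i₁ j₁ ∸ 1) * (q * q) + Lrot q r i₂ j₂ ≡⟨ cong₂ (λ c l → c * (q * q) + l)
                                                     (sym (toℕ-fromℕ< (B-bound i₁ j₁))) (Lrot≡suc-combine q r i₂ j₂) ⟩
  toℕ c * (q * q) + suc (toℕ l)            ≡⟨ +-suc (toℕ c * (q * q)) (toℕ l) ⟩
  suc (toℕ c * (q * q) + toℕ l)            ≡⟨ cong (λ x → suc (x + toℕ l)) (*-comm (toℕ c) (q * q)) ⟩
  suc (q * q * toℕ c + toℕ l)              ≡⟨ cong suc (toℕ-combine c l) ⟨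
  suc (toℕ (combine c l))                  ∎
  where
  open ≡-Reasoning
  r = rotIndex i₁ j₁
  c = Bᶠ i₁ j₁
  l = uncurry combine (rotate r (i₂ , j₂))

blockIndex-injective : ∀ q {x y x′ y′} → blockIndex q x y ≡ blockIndex q x′ y′ → x ≡ x′ × y ≡ y′
blockIndex-injective q {i₁ , i₂} {j₁ , j₂} {i₁′ , i₂′} {j₁′ , j₂′} e =
  cells (Bᶠ-injective i₁ j₁ i₁′ j₁′ (combine-injectiveˡ c l c′ l′ e)) (combine-injectiveʳ c l c′ l′ e)
  where
  c = Bᶠ i₁ j₁
  c′ = Bᶠ i₁′ j₁′
  l = uncurry combine (rotate (rotIndex i₁ j₁) (i₂ , j₂))
  l′ = uncurry combine (rotate (rotIndex i₁′ j₁′) (i₂′ , j₂′))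
  cells : i₁ ≡ i₁′ × j₁ ≡ j₁′ → l ≡ l′ → (i₁ , i₂) ≡ (i₁′ , i₂′) × (j₁ , j₂) ≡ (j₁′ , j₂′)
  cells (refl , refl) l≡l′
    with refl ← rotate-injective (rotIndex i₁ j₁) {i₂ , j₂} {i₂′ , j₂′} (uncurry-combine-injective l≡l′)
    = refl , refl

blockIndex-surjective : ∀ q k → ∃₂ λ x y → blockIndex q x y ≡ k
blockIndex-surjective q k = preimage (Bᶠ-surjective c)
  where
  open ≡-Reasoning
  c = quotient {16} (q * q) k
  l = remainder {16} (q * q) k
  preimage : (∃₂ λ i₁ j₁ → Bᶠ i₁ j₁ ≡ c) → ∃₂ λ x y → blockIndex q x y ≡ k
  preimage (i₁ , j₁ , eB) = (i₁ , proj₁ p) , (j₁ , proj₂ p) , (begin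
    combine (Bᶠ i₁ j₁) (uncurry combine (rotate r p))  ≡⟨ cong₂ combine eB
                                                            (cong (uncurry combine) (rotate-inverseʳ r (remQuot {q} q l))) ⟩
    combine c (uncurry combine (remQuot {q} q l))      ≡⟨ cong (combine c) (combine-remQuot {q} q l) ⟩
    combine c l                                        ≡⟨ combine-remQuot {16} (q * q) k ⟩
    k                                                  ∎)
    where
    r = rotIndex i₁ j₁
    p = rotate (negate₄ r) (remQuot {q} q l)

cellIndex : ∀ q → Fin (4 * q) × Fin (4 * q) → Fin (16 * (q * q))
cellIndex q (i , j) = blockIndex q (remQuot q i) (remQuot q j)

cellIndex-injective : ∀ q {p p′} → cellIndex q p ≡ cellIndex q p′ → p ≡ p′
cellIndex-injective q {i , j} {i′ , j′} e =
  let ei , ej = blockIndex-injective q e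
  in cong₂ _,_ (remQuot-injective q ei) (remQuot-injective q ej)

cellIndex-surjective : ∀ q k → ∃ λ p → cellIndex q p ≡ k
cellIndex-surjective q k = lift (blockIndex-surjective q k)
  where
  lift : (∃₂ λ x y → blockIndex q x y ≡ k) → ∃ λ p → cellIndex q p ≡ k
  lift ((i₁ , i₂) , (j₁ , j₂) , e) =
    (combine i₁ i₂ , combine j₁ j₂) ,
    trans (cong₂ (blockIndex q) (remQuot-combine {4} {q} i₁ i₂) (remQuot-combine {4} {q} j₁ j₂)) e

q^2≡q*q : ∀ q → q ^ 2 ≡ q * q
q^2≡q*q q = cong (q *_) (*-identityʳ q)

W-exactly-once : ∀ q v → 1 ≤ v → v ≤ 16 * q ^ 2 →
                 Σ[ p ∈ Fin (4 * q) × Fin (4 * q) ]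
                   (W q (proj₁ p) (proj₂ p) ≡ v × (∀ i j → W q i j ≡ v → (i , j) ≡ p))
W-exactly-once q v 1≤v v≤16q² = p , Wp≡v , λ i j → unique (i , j)
  where
  once = exactly-once (uncurry (W q)) (cellIndex q)
           (λ p → Wᵇ≡suc-blockIndex q (remQuot q (proj₁ p)) (remQuot q (proj₂ p)))
           (cellIndex-injective q) (cellIndex-surjective q)
           v 1≤v (subst (v ≤_) (cong (16 *_) (q^2≡q*q q)) v≤16q²)
  p = proj₁ once
  Wp≡v = proj₁ (proj₂ once)
  unique = proj₂ (proj₂ once)

-- Line sums

block-line-sum : ∀ q (f : Fin (4 * q) → ℕ) (β : Fin 4 → ℕ) (ρ : Fin 4 → Fin 4) (cell : Fin q → Fin q × Fin q) →
                 (∀ k x → f (combine k x) ≡ β k * (q * q) + uncurry (Lrot q (ρ k)) (cell x)) →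
                 ∑[ k < 4 ] β k ≡ 30 → (∀ h → ∑[ k < 4 ] h (ρ k) ≡ ∑[ r < 4 ] h r) →
                 sum (tabulate f) ≡ 32 * q ^ 3 + 2 * q
block-line-sum q f β ρ cell f≡ ∑β ∑ρ = begin
  sum (tabulate f)                           ≡⟨ sum-tabulate f ⟩
  ∑[ t < 4 * q ] f t                         ≡⟨ ∑-combine 4 {q} f ⟩
  ∑[ k < 4 ] ∑[ x < q ] f (combine k x)      ≡⟨ sum-cong-≗ (λ k → sum-cong-≗ (f≡ k)) ⟩
  ∑[ k < 4 ] ∑[ x < q ] entry k x            ≡⟨ ∑-comm entry ⟩
  ∑[ x < q ] ∑[ k < 4 ] entry k x            ≡⟨ sum-cong-≗ crossing ⟩
  ∑[ x < q ] (32 * (q * q) + 2)              ≡⟨ ∑-const q (32 * (q * q) + 2) ⟩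
  q * (32 * (q * q) + 2)                     ≡⟨ expand q ⟩
  32 * q ^ 3 + 2 * q                         ∎
  where
  open ≡-Reasoning
  collect : ∀ q → 30 * (q * q) + 2 * (q * q + 1) ≡ 32 * (q * q) + 2
  collect = solve-∀
  expand : ∀ q → q * (32 * (q * q) + 2) ≡ 32 * (q * (q * (q * 1))) + 2 * q
  expand = solve-∀
  entry : Fin 4 → Fin q → ℕ
  entry k x = β k * (q * q) + uncurry (Lrot q (ρ k)) (cell x)
  crossing : ∀ x → ∑[ k < 4 ] entry k x ≡ 32 * (q * q) + 2
  crossing x = begin
    ∑[ k < 4 ] entry k x
      ≡⟨ ∑-distrib-+ (λ k → β k * (q * q)) (λ k → uncurry (Lrot q (ρ k)) (cell x)) ⟩
    ∑[ k < 4 ] (β k * (q * q)) + ∑[ k < 4 ] uncurry (Lrot q (ρ k)) (cell x)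
      ≡⟨ cong₂ _+_ (sym (*-distribʳ-sum (q * q) β)) (∑ρ (λ r → uncurry (Lrot q r) (cell x))) ⟩
    ∑[ k < 4 ] β k * (q * q) + ∑[ r < 4 ] uncurry (Lrot q r) (cell x)
      ≡⟨ cong₂ (λ s t → s * (q * q) + t) ∑β (∑-rotations (proj₁ (cell x)) (proj₂ (cell x))) ⟩
    30 * (q * q) + 2 * (q * q + 1)
      ≡⟨ collect q ⟩
    32 * (q * q) + 2
      ∎

row-sum : ∀ q (i : Fin (4 * q)) → sum (tabulate (λ j → W q i j)) ≡ 32 * q ^ 3 + 2 * q
row-sum q = combine-elim _ λ i₁ i₂ →
  block-line-sum q _ (λ j₁ → B i₁ j₁ ∸ 1) (rotIndex i₁) (i₂ ,_) (W-combine q i₁ i₂) (B-row-sum i₁) (∑-rotIndexʳ i₁)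

column-sum : ∀ q (j : Fin (4 * q)) → sum (tabulate (λ i → W q i j)) ≡ 32 * q ^ 3 + 2 * q
column-sum q = combine-elim _ λ j₁ j₂ →
  block-line-sum q _ (λ i₁ → B i₁ j₁ ∸ 1) (λ i₁ → rotIndex i₁ j₁) (_, j₂) (λ i₁ i₂ → W-combine q i₁ i₂ j₁ j₂)
    (B-column-sum j₁) (∑-rotIndexˡ j₁)

-- Runs of consecutive entries

runStart : ℕ → ℕ → ℕ → ℕ
runStart q c t = c * (q * q) + q * t + 1

APIn-image : ∀ {n len a} (f : Fin n → ℕ) (e : Fin len → Fin n) → (∀ x → f (e x) ≡ a + toℕ x) → APIn f a len
APIn-image {a = a} f e h k k<len = e (fromℕ< k<len) , trans (h (fromℕ< k<len)) (cong (a +_) (toℕ-fromℕ< k<len))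

block-AP : ∀ q {n} (f : Fin n → ℕ) (e : Fin q → Fin n) c (t : Fin q) →
           (∀ x → f (e x) ≡ c * (q * q) + L q t x) → APIn f (runStart q c (toℕ t)) q
block-AP q f e c t h = APIn-image f e (λ x → trans (h x) (regroup c (q * q) q (toℕ t) (toℕ x)))
  where
  regroup : ∀ c Q q t x → c * Q + (q * t + x + 1) ≡ c * Q + q * t + 1 + x
  regroup = solve-∀

runStart-disjoint : ∀ q {c d} → c < d → (t : Fin q) (u : ℕ) → runStart q c (toℕ t) + q ≤ runStart q d u
runStart-disjoint q {c} {d} c<d t u = begin
  c * (q * q) + q * toℕ t + 1 + q   ≡⟨ regroup c q (toℕ t) ⟩
  c * (q * q) + q * suc (toℕ t) + 1 ≤⟨ +-monoˡ-≤ 1 (+-monoʳ-≤ (c * (q * q)) (*-monoʳ-≤ q (toℕ<n t))) ⟩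
  c * (q * q) + q * q + 1           ≡⟨ cong (_+ 1) (+-comm (c * (q * q)) (q * q)) ⟩
  suc c * (q * q) + 1               ≤⟨ +-monoˡ-≤ 1 (*-monoˡ-≤ (q * q) c<d) ⟩
  d * (q * q) + 1                   ≤⟨ +-monoˡ-≤ 1 (m≤m+n (d * (q * q)) (q * u)) ⟩
  d * (q * q) + q * u + 1           ∎
  where
  open ≤-Reasoning
  regroup : ∀ c q t → c * (q * q) + q * t + 1 + q ≡ c * (q * q) + q * suc t + 1
  regroup = solve-∀

rowAP⁰ : ∀ q i₁ i₂ j₁ → rotIndex i₁ j₁ ≡ 0F →
         APIn (λ j → W q (combine i₁ i₂) j) (runStart q (B i₁ j₁ ∸ 1) (toℕ i₂)) q
rowAP⁰ q i₁ i₂ j₁ r≡0 = block-AP q _ (combine j₁) (B i₁ j₁ ∸ 1) i₂ λ x →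
  trans (W-combine q i₁ i₂ j₁ x) (cong (λ r → (B i₁ j₁ ∸ 1) * (q * q) + Lrot q r i₂ x) r≡0)

rowAP² : ∀ q i₁ i₂ j₁ → rotIndex i₁ j₁ ≡ 2F →
         APIn (λ j → W q (combine i₁ i₂) j) (runStart q (B i₁ j₁ ∸ 1) (toℕ (opposite i₂))) q
rowAP² q i₁ i₂ j₁ r≡2 = block-AP q _ (combine j₁ ∘ opposite) (B i₁ j₁ ∸ 1) (opposite i₂) λ x →
  trans (W-combine q i₁ i₂ j₁ (opposite x))
        (trans (cong (λ r → (B i₁ j₁ ∸ 1) * (q * q) + Lrot q r i₂ (opposite x)) r≡2)
               (cong (λ y → (B i₁ j₁ ∸ 1) * (q * q) + L q (opposite i₂) y) (opposite-involutive x)))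

columnAP¹ : ∀ q j₁ j₂ i₁ → rotIndex i₁ j₁ ≡ 1F →
            APIn (λ i → W q i (combine j₁ j₂)) (runStart q (B i₁ j₁ ∸ 1) (toℕ (opposite j₂))) q
columnAP¹ q j₁ j₂ i₁ r≡1 = block-AP q _ (combine i₁) (B i₁ j₁ ∸ 1) (opposite j₂) λ x →
  trans (W-combine q i₁ x j₁ j₂) (cong (λ r → (B i₁ j₁ ∸ 1) * (q * q) + Lrot q r x j₂) r≡1)

columnAP³ : ∀ q j₁ j₂ i₁ → rotIndex i₁ j₁ ≡ 3F →
            APIn (λ i → W q i (combine j₁ j₂)) (runStart q (B i₁ j₁ ∸ 1) (toℕ j₂)) q
columnAP³ q j₁ j₂ i₁ r≡3 = block-AP q _ (combine i₁ ∘ opposite) (B i₁ j₁ ∸ 1) j₂ λ x →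
  trans (W-combine q i₁ (opposite x) j₁ j₂)
        (trans (cong (λ r → (B i₁ j₁ ∸ 1) * (q * q) + Lrot q r (opposite x) j₂) r≡3)
               (cong (λ y → (B i₁ j₁ ∸ 1) * (q * q) + L q j₂ y) (opposite-involutive x)))

-- In block-row i₁ the rotation-0 block is j₁ = i₁ and the rotation-2 block is j₁ = i₁ + 2;
-- the literals are the corresponding entries of B − 1.
row-APs : ∀ q (i : Fin (4 * q)) → TwoDisjointAPs (λ j → W q i j) q
row-APs q = combine-elim {4} {q} _ APs
  where
  APs : ∀ i₁ i₂ → TwoDisjointAPs (λ j → W q (combine i₁ i₂) j) q
  APs 0F i₂ = _ , _ , rowAP⁰ q 0F i₂ 0F refl , rowAP² q 0F i₂ 2F refl , runStart-disjoint q (<ᵇ⇒< 0 10 _) i₂ _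
  APs 1F i₂ = _ , _ , rowAP⁰ q 1F i₂ 1F refl , rowAP² q 1F i₂ 3F refl , runStart-disjoint q (<ᵇ⇒< 3 9 _) i₂ _
  APs 2F i₂ = _ , _ , rowAP⁰ q 2F i₂ 2F refl , rowAP² q 2F i₂ 0F refl , runStart-disjoint q (<ᵇ⇒< 1 11 _) i₂ _
  APs 3F i₂ = _ , _ , rowAP⁰ q 3F i₂ 3F refl , rowAP² q 3F i₂ 1F refl , runStart-disjoint q (<ᵇ⇒< 2 8 _) i₂ _

-- In block-column j₁ the rotation-1 and rotation-3 blocks are i₁ = j₁ − 1 and i₁ = j₁ + 1.
column-APs : ∀ q (j : Fin (4 * q)) → TwoDisjointAPs (λ i → W q i j) q
column-APs q = combine-elim {4} {q} _ APs
  where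
  APs : ∀ j₁ j₂ → TwoDisjointAPs (λ i → W q i (combine j₁ j₂)) q
  APs 0F j₂ = _ , _ , columnAP³ q 0F j₂ 1F refl , columnAP¹ q 0F j₂ 3F refl , runStart-disjoint q (<ᵇ⇒< 6 13 _) j₂ _
  APs 1F j₂ = _ , _ , columnAP¹ q 1F j₂ 0F refl , columnAP³ q 1F j₂ 2F refl , runStart-disjoint q (<ᵇ⇒< 5 14 _) (opposite j₂) _
  APs 2F j₂ = _ , _ , columnAP³ q 2F j₂ 3F refl , columnAP¹ q 2F j₂ 1F refl , runStart-disjoint q (<ᵇ⇒< 7 12 _) j₂ _
  APs 3F j₂ = _ , _ , columnAP¹ q 3F j₂ 2F refl , columnAP³ q 3F j₂ 0F refl , runStart-disjoint q (<ᵇ⇒< 4 15 _) (opposite j₂) _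

-- Small entries

W-small⇔sameSide : ∀ q (i j : Fin (4 * q)) → W q i j ≤ 8 * q ^ 2 ⇔ SameSide (2 * q) (toℕ i) (toℕ j)
W-small⇔sameSide q = combine-elim _ λ i₁ i₂ → combine-elim _ λ j₁ j₂ →
  subst₂ (λ w b → w ≤ b ⇔ SameSide (2 * q) (toℕ (combine i₁ i₂)) (toℕ (combine j₁ j₂)))
    (sym (trans (W-combine q i₁ i₂ j₁ j₂) (Wᵇ≡suc-blockIndex q (i₁ , i₂) (j₁ , j₂))))
    (cong (8 *_) (sym (q^2≡q*q q)))
    (⇔-sym (sameSide-combine 2 i₁ j₁ i₂ j₂) ⇔-∘ (Bᶠ-small⇔sameSide i₁ j₁ ⇔-∘ toℕ-combine-< 8 (Bᶠ i₁ j₁) _))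

lemma6p2 : (q : ℕ) → 0 < q →
    -- (1) every value 1..16q² appears exactly once
    (∀ v → 1 ≤ v → v ≤ 16 * q ^ 2 →
      Σ[ p ∈ Fin (4 * q) × Fin (4 * q) ]
        (W q (proj₁ p) (proj₂ p) ≡ v
         × (∀ i j → W q i j ≡ v → (i , j) ≡ p)))
    -- (2) row and column sums
    × (∀ i → sum (tabulate (λ j → W q i j)) ≡ 32 * q ^ 3 + 2 * q)
    × (∀ j → sum (tabulate (λ i → W q i j)) ≡ 32 * q ^ 3 + 2 * q)
    -- (3) two disjoint 1-APs of length q in every row and column
    × (∀ i → TwoDisjointAPs (λ j → W q i j) q)
    × (∀ j → TwoDisjointAPs (λ i → W q i j) q)
    -- (4) small entries exactly in the two diagonal blocks (0-based indices)
    × (∀ i j → (W q i j ≤ 8 * q ^ 2) ⇔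
         ((toℕ i < 2 * q × toℕ j < 2 * q) ⊎ (2 * q ≤ toℕ i × 2 * q ≤ toℕ j)))
-- Every component also holds for q = 0.
lemma6p2 q _ =
  W-exactly-once q , row-sum q , column-sum q , row-APs q , column-APs q , W-small⇔sameSide q
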